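{- Let $n\in\mathbb{N}$. For every edge $e$ of $S_{(n+1)\times n}$, Maker has a winning strategy for the $(1,1)$-crossing game on $S_{(n+1)\times n}$ in which her first move is to claim $e$.
   Context: $S_{m\times n}$ is the graph obtained from the grid graph on $\{(x,y):x\in[m],y\in[n]\}$ (edges between points at Euclidean distance $1$) by deleting all vertical edges with both endpoints having $x=1$ or both having $x=m$. A left-right crossing path joins some $(1,y)$ to some $(m,y')$. In the $(1,1)$-crossing game (Bridg-it), Maker and Breaker alternate turns, Maker first, each claiming one as-yet unclaimed edge per turn; Maker wins if she claims all edges of a left-right crossing path, Breaker wins if it becomes impossible for Maker ever to do so. -}

module Defs where

open import Data.Nat using (ℕ; zero; suc; _∸_; _<_)
open import Data.Fin using (Fin; toℕ)
open import Data.Product using (_×_; _,_; proj₁; proj₂; ∃; ∃-syntax; Σ)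
open import Data.Sum using (_⊎_)
open import Data.Unit using (⊤)
open import Data.List using (List; []; _∷_)
open import Data.List.Membership.Propositional using (_∈_; _∉_)
open import Data.List.Relation.Unary.All using (All)
open import Data.List.Relation.Unary.Unique.Propositional using (Unique)
open import Relation.Binary.PropositionalEquality using (_≡_)

-- Vertices (x , y) with 0-indexed coordinates: paper's (x+1 , y+1).
Vertex : Set
Vertex = ℕ × ℕ

InGrid : ℕ → ℕ → Vertex → Set
InGrid m n (x , y) = (x < m) × (y < n)

-- Edges of S_{m×n} (0-indexed):
--   hor i j : (i , j) — (i+1 , j)        for 0 ≤ i ≤ m-2, 0 ≤ j ≤ n-1
--   ver i j : (i+1 , j) — (i+1 , j+1)    for 0 ≤ i ≤ m-3, 0 ≤ j ≤ n-2
-- (vertical edges only in the interior columns x = 2..m-1 of the paper,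
--  i.e. those in the first and last column are deleted).
data Edge (m n : ℕ) : Set where
  hor : Fin (m ∸ 1) → Fin n → Edge m n
  ver : Fin (m ∸ 2) → Fin (n ∸ 1) → Edge m n

ends : ∀ {m n} → Edge m n → Vertex × Vertex
ends (hor i j) = (toℕ i , toℕ j) , (suc (toℕ i) , toℕ j)
ends (ver i j) = (suc (toℕ i) , toℕ j) , (suc (toℕ i) , suc (toℕ j))

Joins : ∀ {m n} → List (Edge m n) → Vertex → Vertex → Set
Joins M u v = ∃[ e ] (e ∈ M × (ends e ≡ (u , v) ⊎ ends e ≡ (v , u)))

Linked : ∀ {m n} → List (Edge m n) → List Vertex → Set
Linked M [] = ⊤
Linked M (u ∷ []) = ⊤
Linked M (u ∷ v ∷ vs) = Joins M u v × Linked M (v ∷ vs)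

lastOf : Vertex → List Vertex → Vertex
lastOf v [] = v
lastOf v (w ∷ ws) = lastOf w ws

record CrossingPath (m n : ℕ) (M : List (Edge m n)) : Set where
  field
    start      : Vertex
    rest       : List Vertex
    startLeft  : proj₁ start ≡ 0
    endRight   : proj₁ (lastOf start rest) ≡ m ∸ 1
    inGrid     : All (InGrid m n) (start ∷ rest)
    linked     : Linked M (start ∷ rest)
    simple     : Unique (start ∷ rest)

Free : ∀ {m n} → List (Edge m n) → List (Edge m n) → Edge m n → Set
Free M B f = (f ∉ M) × (f ∉ B)

-- MakerWins m n M B: in the position where Maker owns M,
-- Breaker owns B and it is Maker's turn, Maker has a winning strategy.
-- MakerWinsAfter m n M B e: Maker, at such a position, claims the (free)
-- edge e, and from there has a winning strategy: either she has now completed a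
-- crossing path, or Breaker has a move available (otherwise the board is full
-- without a Maker crossing, so Breaker has won) and every Breaker reply
-- leads to a position winning for Maker.
data MakerWins (m n : ℕ) (M B : List (Edge m n)) : Set
data MakerWinsAfter (m n : ℕ) (M B : List (Edge m n)) (e : Edge m n) : Set

data MakerWins m n M B where
  won  : CrossingPath m n M → MakerWins m n M B
  play : (e : Edge m n) → Free M B e → MakerWinsAfter m n M B e → MakerWins m n M B

data MakerWinsAfter m n M B e where
  won  : CrossingPath m n (e ∷ M) → MakerWinsAfter m n M B e
  cont : (∃[ f ] Free (e ∷ M) B f)
       → ((f : Edge m n) → Free (e ∷ M) B f → MakerWins m n (e ∷ M) (f ∷ B))
       → MakerWinsAfter m n M B e

module Submission where

-- Contract the left column of S_{m×n} to one vertex and the right column to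
-- another, and call a set of edges spanning if it connects all vertices of the
-- contracted board.  A spanning set joins left to right, so it contains a
-- crossing path.  The proof is the Shannon/Lehman strategy for two
-- edge-disjoint spanning sets:
--   * (general boards) if P and R are disjoint, e ∈ P, and both P and R ∪ {e}
--     span, Maker wins after claiming e.  She keeps two disjoint reserves C₁, C₂
--     of free edges with C₁ ∪ M and C₂ ∪ M spanning (M = her edges); when
--     Breaker takes f from one reserve, a repair lemma yields an edge g of the
--     other reserve that restores connectivity, and Maker claims g.  When a
--     reserve is empty, M itself spans, and a loop-erased walk in M gives a
--     crossing path.
--   * (the board S_{(n+1)×n}) for every edge e a "staircase" pair (P , R) with the
--     above properties is constructed explicitly.

open import Defs
open import Data.Nat using (ℕ; zero; suc; _+_; _∸_; _<_; _≤_; z≤n; s≤s; z<s; _<?_; _≤?_)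
open import Data.Nat.Properties
open import Data.Nat.DivMod using (_%_; m<n⇒m%n≡m; [m+n]%n≡m%n; m%n<n)
open import Data.Nat.Tactic.RingSolver using (solve-∀)
open import Data.Bool using (Bool; true; false)
import Data.Bool.Properties as BoolP
open import Data.Fin using (toℕ; fromℕ<)
import Data.Fin as F
import Data.Fin.Properties as FP
open import Data.Product using (Σ; _×_; _,_; proj₁; proj₂)
open import Data.Product.Properties using (≡-dec)
open import Data.Sum using (_⊎_; inj₁; inj₂; [_,_]′) renaming (map to ⊎-map)
open import Data.Unit using (tt)
open import Data.Empty
open import Data.List using (List; []; _∷_; _++_; length; filter; map; cartesianProduct; allFin)
open import Data.List.Properties using (length-filter; filter-notAll)
open import Data.List.Membership.Propositional using (_∈_; _∉_)
open import Data.List.Membership.Propositional.Properties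
open import Data.List.Relation.Binary.Subset.Propositional using (_⊆_)
open import Data.List.Relation.Unary.Any as Any using (here; there)
open import Data.List.Relation.Unary.All using (All; []; _∷_)
open import Data.List.Relation.Unary.All.Properties using (¬Any⇒All¬)
open import Data.List.Relation.Unary.Unique.Propositional using (Unique)
open import Data.List.Relation.Unary.AllPairs using ([]; _∷_)
open import Relation.Binary.PropositionalEquality
open import Relation.Nullary
open import Relation.Nullary.Decidable using (¬?; _×-dec_)

module _ {m n : ℕ} where

  _≟E_ : (e f : Edge m n) → Dec (e ≡ f)
  hor i j ≟E hor i' j' with i F.≟ i' | j F.≟ j'
  ... | yes refl | yes refl = yes refl
  ... | no i≢i'  | _        = no λ { refl → i≢i' refl }
  ... | yes _    | no j≢j'  = no λ { refl → j≢j' refl }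
  hor _ _ ≟E ver _ _ = no λ ()
  ver _ _ ≟E hor _ _ = no λ ()
  ver i j ≟E ver i' j' with i F.≟ i' | j F.≟ j'
  ... | yes refl | yes refl = yes refl
  ... | no i≢i'  | _        = no λ { refl → i≢i' refl }
  ... | yes _    | no j≢j'  = no λ { refl → j≢j' refl }

  _without_ : List (Edge m n) → Edge m n → List (Edge m n)
  xs without f = filter (λ x → ¬? (x ≟E f)) xs

  without-⊆ : ∀ {f} xs → xs without f ⊆ xs
  without-⊆ {f} xs x∈ = proj₁ (∈-filter⁻ (λ x → ¬? (x ≟E f)) {xs = xs} x∈)

  without-≢ : ∀ {f x} xs → x ∈ xs without f → x ≢ f
  without-≢ {f} xs x∈ = proj₂ (∈-filter⁻ (λ x → ¬? (x ≟E f)) {xs = xs} x∈)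

  without-∈ : ∀ {f x} xs → x ∈ xs → x ≢ f → x ∈ xs without f
  without-∈ {f} xs = ∈-filter⁺ (λ x → ¬? (x ≟E f)) {xs = xs}

  without-length≤ : ∀ f xs → length (xs without f) ≤ length xs
  without-length≤ f = length-filter (λ x → ¬? (x ≟E f))

  without-length< : ∀ f xs → f ∈ xs → length (xs without f) < length xs
  without-length< f xs f∈ = filter-notAll (λ x → ¬? (x ≟E f)) xs (Any.map (λ f≡x x≢f → x≢f (sym f≡x)) f∈)

  ++-without-⊆ : ∀ {g} (A M : List (Edge m n)) → A ++ M ⊆ (A without g) ++ g ∷ M
  ++-without-⊆ {g} A M {x} x∈ with ∈-++⁻ A x∈
  ... | inj₂ x∈M = ∈-++⁺ʳ (A without g) (there x∈M)
  ... | inj₁ x∈A with x ≟E g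
  ...   | yes refl = ∈-++⁺ʳ (A without g) (here refl)
  ...   | no x≢g   = ∈-++⁺ˡ (without-∈ A x∈A x≢g)

module Board (m' n' : ℕ) where

  E : Set
  E = Edge (suc m') (suc n')

  OnBoard : Vertex → Set
  OnBoard = InGrid (suc m') (suc n')

  endsOnBoard : (e : E) → OnBoard (proj₁ (ends e)) × OnBoard (proj₂ (ends e))
  endsOnBoard (hor i j) = (m<n⇒m<1+n (FP.toℕ<n i) , FP.toℕ<n j) , (s≤s (FP.toℕ<n i) , FP.toℕ<n j)
  endsOnBoard (ver i j) = (x< , m<n⇒m<1+n (FP.toℕ<n j)) , (x< , s≤s (FP.toℕ<n j))
    where
      x< : suc (toℕ i) < suc m'
      x< = s≤s (≤-trans (FP.toℕ<n i) (m∸n≤m m' 1))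

  -- A step of a walk on the board with its left and its right column each
  -- contracted to a point: along an edge of S, or anywhere inside column 0 or m'.
  data Step (S : List E) : Vertex → Vertex → Set where
    edge     : ∀ {u v} → Joins S u v → Step S u v
    leftCol  : ∀ {y y'} → y < suc n' → y' < suc n' → Step S (0 , y) (0 , y')
    rightCol : ∀ {y y'} → y < suc n' → y' < suc n' → Step S (m' , y) (m' , y')

  infixr 5 _▸_
  data Walk (S : List E) : Vertex → Vertex → Set where
    ε   : ∀ {u} → Walk S u u
    _▸_ : ∀ {u w v} → Step S u w → Walk S w v → Walk S u v

  infixr 5 _++w_
  _++w_ : ∀ {S u v w} → Walk S u v → Walk S v w → Walk S u w
  ε       ++w w = w
  (s ▸ r) ++w w = s ▸ (r ++w w)

  joinsSym : ∀ {S : List E} {u v} → Joins S u v → Joins S v u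
  joinsSym (e , e∈ , inj₁ eq) = e , e∈ , inj₂ eq
  joinsSym (e , e∈ , inj₂ eq) = e , e∈ , inj₁ eq

  stepSym : ∀ {S u v} → Step S u v → Step S v u
  stepSym (edge j)       = edge (joinsSym j)
  stepSym (leftCol p q)  = leftCol q p
  stepSym (rightCol p q) = rightCol q p

  reverse : ∀ {S u v} → Walk S u v → Walk S v u
  reverse ε       = ε
  reverse (s ▸ r) = reverse r ++w (stepSym s ▸ ε)

  stepMono : ∀ {S S' u v} → S ⊆ S' → Step S u v → Step S' u v
  stepMono sub (edge (e , e∈ , eq)) = edge (e , sub e∈ , eq)
  stepMono sub (leftCol p q)        = leftCol p q
  stepMono sub (rightCol p q)       = rightCol p q

  walkMono : ∀ {S S' u v} → S ⊆ S' → Walk S u v → Walk S' u v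
  walkMono sub ε       = ε
  walkMono sub (s ▸ r) = stepMono sub s ▸ walkMono sub r

  stepOnBoard : ∀ {S u v} → Step S u v → OnBoard u × OnBoard v
  stepOnBoard (edge (e , _ , inj₁ eq)) =
    subst OnBoard (cong proj₁ eq) (proj₁ (endsOnBoard e)) , subst OnBoard (cong proj₂ eq) (proj₂ (endsOnBoard e))
  stepOnBoard (edge (e , _ , inj₂ eq)) =
    subst OnBoard (cong proj₂ eq) (proj₂ (endsOnBoard e)) , subst OnBoard (cong proj₁ eq) (proj₁ (endsOnBoard e))
  stepOnBoard (leftCol p q)  = (s≤s z≤n , p) , (s≤s z≤n , q)
  stepOnBoard (rightCol p q) = (≤-refl , p) , (≤-refl , q)

  allEdges : List E
  allEdges = map (λ ij → hor (proj₁ ij) (proj₂ ij)) (cartesianProduct (allFin m') (allFin (suc n')))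
          ++ map (λ ij → ver (proj₁ ij) (proj₂ ij)) (cartesianProduct (allFin (m' ∸ 1)) (allFin n'))

  allEdges-complete : ∀ e → e ∈ allEdges
  allEdges-complete (hor i j) =
    ∈-++⁺ˡ (∈-map⁺ (λ ij → hor {suc m'} {suc n'} (proj₁ ij) (proj₂ ij))
                   (∈-cartesianProduct⁺ (∈-allFin i) (∈-allFin j)))
  allEdges-complete (ver i j) =
    ∈-++⁺ʳ _ (∈-map⁺ (λ ij → ver {suc m'} {suc n'} (proj₁ ij) (proj₂ ij))
                     (∈-cartesianProduct⁺ (∈-allFin i) (∈-allFin j)))

  horStep : ∀ {S} k y (k< : k < m') (y< : y < suc n') → hor (fromℕ< k<) (fromℕ< y<) ∈ S →
            Step S (k , y) (suc k , y)
  horStep k y k< y< e∈ =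
    edge (_ , e∈ , inj₁ (cong₂ (λ a c → ((a , c) , (suc a , c))) (FP.toℕ-fromℕ< k<) (FP.toℕ-fromℕ< y<)))

  verStep : ∀ {S} i j (i< : i < m' ∸ 1) (j< : j < n') → ver (fromℕ< i<) (fromℕ< j<) ∈ S →
            Step S (suc i , j) (suc i , suc j)
  verStep i j i< j< e∈ =
    edge (_ , e∈ , inj₁ (cong₂ (λ a c → ((suc a , c) , (suc a , suc c))) (FP.toℕ-fromℕ< i<) (FP.toℕ-fromℕ< j<)))

  Span : List E → Set
  Span S = ∀ {u v} → OnBoard u → OnBoard v → Walk S u v

  spanFrom : ∀ {S} hub → (∀ {w} → OnBoard w → Walk S w hub) → Span S
  spanFrom hub toHub u∈ v∈ = toHub u∈ ++w reverse (toHub v∈)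

  spanMono : ∀ {S S'} → S ⊆ S' → Span S → Span S'
  spanMono sub span u∈ v∈ = walkMono sub (span u∈ v∈)

  module CrossingFromSpan (M : List E) where

    PathToRight : Vertex → Set
    PathToRight u = Σ (List Vertex) λ rest →
      Linked M (u ∷ rest) × All OnBoard (u ∷ rest) × proj₁ (lastOf u rest) ≡ m'

    -- Cut a walk ending in the right column after its last contracted step:
    -- the remainder is an M-path, starting at u or at some left-column vertex.
    lastLeftSegment : ∀ {u v} → Walk M u v → proj₁ v ≡ m' → OnBoard u →
                      PathToRight u ⊎ Σ Vertex (λ u' → proj₁ u' ≡ 0 × PathToRight u')
    lastLeftSegment ε v-right u∈ = inj₁ ([] , tt , u∈ ∷ [] , v-right)
    lastLeftSegment (_▸_ {w = w} (edge j) r) v-right u∈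
      with lastLeftSegment r v-right (proj₂ (stepOnBoard (edge j)))
    ... | inj₁ (rest , linked , onBoard , ends) = inj₁ (w ∷ rest , (j , linked) , u∈ ∷ onBoard , ends)
    ... | inj₂ later = inj₂ later
    lastLeftSegment (_▸_ {w = w} (leftCol p q) r) v-right u∈
      with lastLeftSegment r v-right (proj₂ (stepOnBoard {M} (leftCol p q)))
    ... | inj₁ path  = inj₂ (w , refl , path)
    ... | inj₂ later = inj₂ later
    lastLeftSegment (rightCol p q ▸ r) v-right u∈ = inj₁ ([] , tt , u∈ ∷ [] , refl)

    suffixFrom : ∀ {u} xs → u ∈ xs → Σ (List Vertex) λ suf →
      (Linked M xs → Linked M (u ∷ suf)) × (All OnBoard xs → All OnBoard (u ∷ suf)) ×
      (Unique xs → Unique (u ∷ suf)) × (∀ z → lastOf z xs ≡ lastOf u suf)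
    suffixFrom (x ∷ xs) (here refl) = xs , (λ l → l) , (λ a → a) , (λ q → q) , λ z → refl
    suffixFrom (x ∷ []) (there ())
    suffixFrom (x ∷ y ∷ xs) (there u∈) with suffixFrom (y ∷ xs) u∈
    ... | suf , linked , onBoard , unique , last =
      suf , (λ l → linked (proj₂ l)) , (λ { (_ ∷ a) → onBoard a }) , (λ { (_ ∷ q) → unique q }) , (λ z → last y)

    -- Loop erasure: whenever the head recurs later, jump to its last occurrence.
    loopErase : ∀ u rest → Linked M (u ∷ rest) → All OnBoard (u ∷ rest) →
      Σ (List Vertex) λ rest' → Linked M (u ∷ rest') × All OnBoard (u ∷ rest') ×
                                Unique (u ∷ rest') × lastOf u rest' ≡ lastOf u rest
    loopErase u [] _ onBoard = [] , tt , onBoard , ([] ∷ []) , refl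
    loopErase u (v ∷ rest) (j , linked) (u∈ ∷ onBoard)
      with loopErase v rest linked onBoard
    ... | rest' , linked' , onBoard' , unique' , last'
      with Any.any? (≡-dec _≟_ _≟_ u) (v ∷ rest')
    ... | yes recurs with suffixFrom (v ∷ rest') recurs
    ...   | suf , l , a , q , last = suf , l linked' , a onBoard' , q unique' , trans (sym (last u)) last'
    loopErase u (v ∷ rest) (j , linked) (u∈ ∷ onBoard)
        | rest' , linked' , onBoard' , unique' , last' | no fresh =
      v ∷ rest' , (j , linked') , u∈ ∷ onBoard' , (¬Any⇒All¬ (v ∷ rest') fresh ∷ unique') , last'

    toCrossing : ∀ u → PathToRight u → proj₁ u ≡ 0 → CrossingPath (suc m') (suc n') M
    toCrossing u (rest , linked , onBoard , ends) u-left with loopErase u rest linked onBoard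
    ... | rest' , linked' , onBoard' , unique' , last' = record
      { start = u ; rest = rest' ; startLeft = u-left ; endRight = trans (cong proj₁ last') ends
      ; inGrid = onBoard' ; linked = linked' ; simple = unique' }

    crossing : Span M → CrossingPath (suc m') (suc n') M
    crossing span with lastLeftSegment (span {0 , 0} {m' , 0} (s≤s z≤n , s≤s z≤n) (≤-refl , s≤s z≤n)) refl
                                       (s≤s z≤n , s≤s z≤n)
    ... | inj₁ path                = toCrossing (0 , 0) path refl
    ... | inj₂ (u , u-left , path) = toCrossing u path u-left

  open CrossingFromSpan using (crossing)

  -- Let D ∪ M and A ∪ M span and let f be removed from D.  Then
  -- every vertex still reaches an end p or q of f inside D' ∪ M (D' = D without f).
  -- An (A ∪ M)-walk from p to q first passes from p's side to q's side across a
  -- contracted step or an edge of M (then D' ∪ M spans) or across an edge g ∈ A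
  -- (then D' ∪ {g} ∪ M spans).
  module Repair (M A D : List E) (f : E) where
    p q : Vertex
    p = proj₁ (ends f)
    q = proj₂ (ends f)

    D' DM : List E
    D' = D without f
    DM = D' ++ M

    p∈ : OnBoard p
    p∈ = proj₁ (endsOnBoard f)

    keep : ∀ {e} → e ≢ f → e ∈ D ++ M → e ∈ DM
    keep {e} e≢f e∈ with ∈-++⁻ D e∈
    ... | inj₁ e∈D = ∈-++⁺ˡ (without-∈ D e∈D e≢f)
    ... | inj₂ e∈M = ∈-++⁺ʳ D' e∈M

    insert-⊆ : ∀ g → DM ⊆ D' ++ g ∷ M
    insert-⊆ g x∈ with ∈-++⁻ D' x∈
    ... | inj₁ x∈D' = ∈-++⁺ˡ x∈D'
    ... | inj₂ x∈M  = ∈-++⁺ʳ D' (there x∈M)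

    prepend : ∀ {u w z} → Step DM u w → Walk DM w z ⊎ (Walk DM w p ⊎ Walk DM w q) →
              Walk DM u z ⊎ (Walk DM u p ⊎ Walk DM u q)
    prepend s = ⊎-map (s ▸_) (⊎-map (s ▸_) (s ▸_))

    avoidOrReach : ∀ {w v} → Walk (D ++ M) w v → Walk DM w v ⊎ (Walk DM w p ⊎ Walk DM w q)
    avoidOrReach ε = inj₁ ε
    avoidOrReach (leftCol a b ▸ r)  = prepend (leftCol a b) (avoidOrReach r)
    avoidOrReach (rightCol a b ▸ r) = prepend (rightCol a b) (avoidOrReach r)
    avoidOrReach {w} (edge (e , e∈ , dir) ▸ r) with e ≟E f
    ... | no e≢f = prepend (edge (e , keep e≢f e∈ , dir)) (avoidOrReach r)
    avoidOrReach {w} (edge (e , e∈ , inj₁ eq) ▸ r) | yes refl =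
      inj₂ (inj₁ (subst (Walk DM w) (cong proj₁ (sym eq)) ε))
    avoidOrReach {w} (edge (e , e∈ , inj₂ eq) ▸ r) | yes refl =
      inj₂ (inj₂ (subst (Walk DM w) (cong proj₂ (sym eq)) ε))

    Side : Set
    Side = ∀ {w} → OnBoard w → Walk DM w p ⊎ Walk DM w q

    sides : Span (D ++ M) → Side
    sides span w∈ with avoidOrReach (span w∈ p∈)
    ... | inj₁ toP = inj₁ toP
    ... | inj₂ toEnd = toEnd

    Bridge : Set
    Bridge = Walk DM p q ⊎ Σ E (λ g → g ∈ A × Walk (D' ++ g ∷ M) p q)

    firstCrossing : Side → ∀ {u} → Walk (A ++ M) u q → Walk DM u p → Bridge
    firstCrossing side ε u→p = inj₁ (reverse u→p)
    firstCrossing side (s ▸ r) u→p with side (proj₂ (stepOnBoard s))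
    ... | inj₁ w→p = firstCrossing side r w→p
    firstCrossing side (leftCol a b ▸ r) u→p  | inj₂ w→q = inj₁ (reverse u→p ++w (leftCol a b ▸ w→q))
    firstCrossing side (rightCol a b ▸ r) u→p | inj₂ w→q = inj₁ (reverse u→p ++w (rightCol a b ▸ w→q))
    firstCrossing side (edge (g , g∈ , dir) ▸ r) u→p | inj₂ w→q with ∈-++⁻ A g∈
    ... | inj₁ g∈A = inj₂ (g , g∈A , walkMono (insert-⊆ g) (reverse u→p)
                                  ++w (edge (g , ∈-++⁺ʳ D' (here refl) , dir) ▸ walkMono (insert-⊆ g) w→q))
    ... | inj₂ g∈M = inj₁ (reverse u→p ++w (edge (g , ∈-++⁺ʳ D' g∈M , dir) ▸ w→q))

    repair : Span (A ++ M) → Span (D ++ M) → Span DM ⊎ Σ E (λ g → g ∈ A × Span (D' ++ g ∷ M))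
    repair spanA spanD with firstCrossing (sides spanD) (spanA p∈ (proj₂ (endsOnBoard f))) ε
    ... | inj₁ p→q = inj₁ (spanFrom p λ w∈ →
            [ (λ w→p → w→p) , (λ w→q → w→q ++w reverse p→q) ]′ (sides spanD w∈))
    ... | inj₂ (g , g∈A , p→q) = inj₂ (g , g∈A , spanFrom p λ w∈ →
            [ walkMono (insert-⊆ g) , (λ w→q → walkMono (insert-⊆ g) w→q ++w reverse p→q) ]′ (sides spanD w∈))

  exchange : ∀ M A D f g₀ → Span (g₀ ∷ A ++ M) → Span (D ++ M) →
             Σ E λ g → g ∈ g₀ ∷ A × Span ((D without f) ++ g ∷ M)
  exchange M A D f g₀ spanA spanD with Repair.repair M (g₀ ∷ A) D f spanA spanD
  ... | inj₁ span = g₀ , here refl , spanMono (Repair.insert-⊆ M (g₀ ∷ A) D f g₀) span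
  ... | inj₂ found = found

  record Reserves (M B C₁ C₂ : List E) : Set where
    field
      free₁  : ∀ {x} → x ∈ C₁ → Free M B x
      free₂  : ∀ {x} → x ∈ C₂ → Free M B x
      apart  : ∀ {x} → x ∈ C₁ → x ∉ C₂
      span₁  : Span (C₁ ++ M)
      span₂  : Span (C₂ ++ M)
  open Reserves

  swap : ∀ {M B C₁ C₂} → Reserves M B C₁ C₂ → Reserves M B C₂ C₁
  swap res = record { free₁ = free₂ res ; free₂ = free₁ res ; apart = λ x₂ x₁ → apart res x₁ x₂
                    ; span₁ = span₂ res ; span₂ = span₁ res }

  afterExchange : ∀ {M B A D f g} → Reserves M B A D → f ∉ A → g ∈ A →
                  Span ((D without f) ++ g ∷ M) → Reserves (g ∷ M) (f ∷ B) (A without g) (D without f)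
  afterExchange {M} {B} {A} {D} {f} {g} res f∉A g∈A span = record
    { free₁ = λ {x} x∈ → let x∈A = without-⊆ A x∈ in
        (λ { (here x≡g) → without-≢ A x∈ x≡g ; (there x∈M) → proj₁ (free₁ res x∈A) x∈M })
      , (λ { (here x≡f) → f∉A (subst (_∈ A) x≡f x∈A) ; (there x∈B) → proj₂ (free₁ res x∈A) x∈B })
    ; free₂ = λ {x} x∈ → let x∈D = without-⊆ D x∈ in
        (λ { (here x≡g) → apart res (subst (_∈ A) (sym x≡g) g∈A) x∈D ; (there x∈M) → proj₁ (free₂ res x∈D) x∈M })
      , (λ { (here x≡f) → without-≢ D x∈ x≡f ; (there x∈B) → proj₂ (free₂ res x∈D) x∈B })
    ; apart = λ x∈A x∈D → apart res (without-⊆ A x∈A) (without-⊆ D x∈D)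
    ; span₁ = spanMono (++-without-⊆ A M) (span₁ res)
    ; span₂ = span }

  open import Data.List.Membership.DecPropositional (_≟E_ {suc m'} {suc n'}) using (_∈?_)

  -- Maker's strategy, by recursion on a bound for the total size of the reserves.
  mutual
    -- Maker has just claimed g.  An empty reserve means her edges span; otherwise
    -- Breaker still has a move, and every reply is answered.
    afterMaker : ∀ k {M B g C₁ C₂} → length C₁ + length C₂ ≤ k →
                 Reserves (g ∷ M) B C₁ C₂ → MakerWinsAfter (suc m') (suc n') M B g
    afterMaker k {C₁ = []}    size res = won (crossing _ (span₁ res))
    afterMaker k {C₁ = x ∷ _} size res = cont (x , free₁ res (here refl)) (λ f _ → afterBreaker k size res f)

    afterBreaker : ∀ k {M B C₁ C₂} → length C₁ + length C₂ ≤ k → Reserves M B C₁ C₂ →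
                   ∀ f → MakerWins (suc m') (suc n') M (f ∷ B)
    afterBreaker k {C₁ = C₁} {C₂} size res f with f ∈? C₁
    ... | yes f∈C₁ = answer k (subst (_≤ k) (+-comm (length C₁) (length C₂)) size) (swap res) (apart res f∈C₁)
    ... | no  f∉C₁ = answer k size res f∉C₁

    answer : ∀ k {M B A D f} → length A + length D ≤ k → Reserves M B A D → f ∉ A →
             MakerWins (suc m') (suc n') M (f ∷ B)
    answer k       {A = []}     size res f∉A = won (crossing _ (span₁ res))
    answer (suc k) {M} {B} {g₀ ∷ A} {D} {f} size res f∉A with exchange M A D f g₀ (span₁ res) (span₂ res)
    ... | g , g∈A , span =
      play g (proj₁ (free₁ res g∈A) , g∉f∷B) (afterMaker k smaller (afterExchange res f∉A g∈A span))
      where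
        g∉f∷B : g ∉ f ∷ B
        g∉f∷B (here g≡f)  = f∉A (subst (_∈ g₀ ∷ A) g≡f g∈A)
        g∉f∷B (there g∈B) = proj₂ (free₁ res g∈A) g∈B

        smaller : length ((g₀ ∷ A) without g) + length (D without f) ≤ k
        smaller = ≤-pred (≤-trans (+-mono-≤ (without-length< g (g₀ ∷ A) g∈A) (without-length≤ f D)) size)

  record SpanningPair (e : E) : Set where
    field
      P R      : List E
      e∈P      : e ∈ P
      separate : ∀ {x} → x ∈ P → x ∉ R
      spanP    : Span P
      spanR+e  : Span (R ++ e ∷ [])

  makerWinsFromPair : ∀ e → SpanningPair e → MakerWinsAfter (suc m') (suc n') [] [] e
  makerWinsFromPair e pair = afterMaker _ ≤-refl reserves
    where
      open SpanningPair pair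
      reserves : Reserves (e ∷ []) [] (P without e) R
      reserves = record
        { free₁ = λ x∈ → (λ { (here x≡e) → without-≢ P x∈ x≡e ; (there ()) }) , λ ()
        ; free₂ = λ x∈ → (λ { (here x≡e) → separate (subst (_∈ P) (sym x≡e) e∈P) x∈ ; (there ()) }) , λ ()
        ; apart = λ x∈ → separate (without-⊆ P x∈)
        ; span₁ = spanMono (λ x∈ → ++-without-⊆ P [] (∈-++⁺ˡ x∈)) spanP
        ; span₂ = spanR+e }

-- The board S_{(n+1)×n}: n = n' + 1 rows, columns x = 0 … n, and n horizontal
-- edges in every row.  West and east are the contracted left and right columns.
module Square (n' : ℕ) where
  n : ℕ
  n = suc n'

  open Board n n'

  west east : Vertex
  west = (0 , 0)
  east = (n , 0)

  0<n : 0 < n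
  0<n = s≤s z≤n

  toWest : ∀ {S y} → y < n → Walk S (0 , y) west
  toWest y< = leftCol y< 0<n ▸ ε

  toEast : ∀ {S y} → y < n → Walk S (n , y) east
  toEast y< = rightCol y< 0<n ▸ ε

  -- R consists of
  --   * in row r+1, every horizontal edge except the one at column cut r = (r+t) mod n,
  --   * every vertical edge between rows 0 and 1,
  -- and P of all other edges: row 0, the vertical edges above row 1 and the cut
  -- edges, which link column x to column x+1 like a staircase.  With kink set,
  -- the row-0 edge at column t moves from P to R and the vertical edge at
  -- column t between rows 0 and 1 moves from R to P.
  module Staircase (t : ℕ) (kink : Bool) (1≤t : 1 ≤ t) (t≤n : t ≤ n) (kink⇒t<n : kink ≡ true → t < n) where

    cut : ℕ → ℕ
    cut r = (r + t) % n

    cut-below : ∀ r v → r + t ≡ v → v < n → cut r ≡ v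
    cut-below r v eq v<n = trans (cong (_% n) eq) (m<n⇒m%n≡m v<n)

    cut-wrap : ∀ r v → r + t ≡ v + n → v < n → cut r ≡ v
    cut-wrap r v eq v<n = trans (cong (_% n) eq) (trans ([m+n]%n≡m%n v n) (m<n⇒m%n≡m v<n))

    cut-shift : ∀ r k → r + t ≡ k ⊎ r + t ≡ k + n → k < n → cut r ≡ k
    cut-shift r k (inj₁ eq) = cut-below r k eq
    cut-shift r k (inj₂ eq) = cut-wrap r k eq

    cut<n : ∀ r → cut r < n
    cut<n r = m%n<n (r + t) n

    InRHor : ℕ → ℕ → Set
    InRHor k zero    = (kink ≡ true) × (k ≡ t)
    InRHor k (suc r) = k ≢ cut r

    InRVer : ℕ → ℕ → Set
    InRVer i zero    = ¬ ((kink ≡ true) × (suc i ≡ t))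
    InRVer i (suc j) = ⊥

    InR : E → Set
    InR (hor i j) = InRHor (toℕ i) (toℕ j)
    InR (ver i j) = InRVer (toℕ i) (toℕ j)

    InR? : (e : E) → Dec (InR e)
    InR? (hor i j) = decHor (toℕ i) (toℕ j)
      where
        decHor : ∀ k y → Dec (InRHor k y)
        decHor k zero    = (kink BoolP.≟ true) ×-dec (k ≟ t)
        decHor k (suc r) = ¬? (k ≟ cut r)
    InR? (ver i j) = decVer (toℕ i) (toℕ j)
      where
        decVer : ∀ i j → Dec (InRVer i j)
        decVer i zero    = ¬? ((kink BoolP.≟ true) ×-dec (suc i ≟ t))
        decVer i (suc j) = no λ ()

    P R : List E
    P = filter (λ e → ¬? (InR? e)) allEdges
    R = filter InR? allEdges

    separate : ∀ {x} → x ∈ P → x ∉ R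
    separate x∈P x∈R =
      proj₂ (∈-filter⁻ (λ e → ¬? (InR? e)) {xs = allEdges} x∈P) (proj₂ (∈-filter⁻ InR? {xs = allEdges} x∈R))

    inP : ∀ e → ¬ InR e → e ∈ P
    inP e = ∈-filter⁺ (λ e → ¬? (InR? e)) {xs = allEdges} (allEdges-complete e)

    inR : ∀ e → InR e → e ∈ R
    inR e = ∈-filter⁺ InR? {xs = allEdges} (allEdges-complete e)

    horP : ∀ k y (k< : k < n) (y< : y < n) → ¬ InRHor k y → Step P (k , y) (suc k , y)
    horP k y k< y< h = horStep k y k< y< (inP _ (subst₂ (λ a c → ¬ InRHor a c)
                         (sym (FP.toℕ-fromℕ< k<)) (sym (FP.toℕ-fromℕ< y<)) h))

    horR : ∀ k y (k< : k < n) (y< : y < n) → InRHor k y → Step R (k , y) (suc k , y)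
    horR k y k< y< h = horStep k y k< y< (inR _ (subst₂ InRHor (sym (FP.toℕ-fromℕ< k<)) (sym (FP.toℕ-fromℕ< y<)) h))

    verP : ∀ i j (i< : i < n') (j< : j < n') → ¬ InRVer i j → Step P (suc i , j) (suc i , suc j)
    verP i j i< j< h = verStep i j i< j< (inP _ (subst₂ (λ a c → ¬ InRVer a c)
                         (sym (FP.toℕ-fromℕ< i<)) (sym (FP.toℕ-fromℕ< j<)) h))

    verR : ∀ i j (i< : i < n') (j< : j < n') → InRVer i j → Step R (suc i , j) (suc i , suc j)
    verR i j i< j< h = verStep i j i< j< (inR _ (subst₂ InRVer (sym (FP.toℕ-fromℕ< i<)) (sym (FP.toℕ-fromℕ< j<)) h))

    rowWest : ∀ r x → suc r < n → x ≤ cut r → Walk R (x , suc r) west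
    rowWest r zero    y< x≤cut = toWest y<
    rowWest r (suc x) y< x<cut =
      stepSym (horR x (suc r) (<⇒≤ (≤-<-trans x<cut (cut<n r))) y< (<⇒≢ x<cut)) ▸ rowWest r x y< (<⇒≤ x<cut)

    rowEast : ∀ r x → suc r < n → x ≤ n → cut r < x → Walk R (x , suc r) east
    rowEast r x y< x≤n = go (n ∸ x) x (m+[n∸m]≡n x≤n)
      where
        go : ∀ d x → x + d ≡ n → cut r < x → Walk R (x , suc r) east
        go zero    x x+0≡n cut<x =
          subst (λ z → Walk R (z , suc r) east) (sym (trans (sym (+-identityʳ x)) x+0≡n)) (toEast y<)
        go (suc d) x x+d≡n cut<x =
          horR x (suc r) (subst (x <_) x+d≡n (m<m+n x z<s)) y< (λ x≡cut → <⇒≢ cut<x (sym x≡cut))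
          ▸ go d (suc x) (trans (sym (+-suc x d)) x+d≡n) (m<n⇒m<1+n cut<x)

    rowSide : ∀ r x → suc r < n → x ≤ n → Walk R (x , suc r) west ⊎ Walk R (x , suc r) east
    rowSide r x y< x≤n with x ≤? cut r
    ... | yes x≤cut = inj₁ (rowWest r x y< x≤cut)
    ... | no  x≰cut = inj₂ (rowEast r x y< x≤n (≰⇒> x≰cut))

    -- A column i+1 ≤ n other than the right one is interior, so carries vertical edges.
    interior : ∀ {i} → suc i ≤ n → suc i ≢ n → i < n'
    interior i+1≤n i+1≢n = ≤-pred (≤∧≢⇒< i+1≤n i+1≢n)

    -- R: a row-0 vertex off the kink climbs its R-edge into row 1.
    row0Side' : ∀ x → x ≤ n → ¬ ((kink ≡ true) × (x ≡ t)) → Walk R (x , 0) west ⊎ Walk R (x , 0) east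
    row0Side' zero    _   _ = inj₁ ε
    row0Side' (suc i) x≤n notKink with suc i ≟ n
    ... | yes x≡n = inj₂ (subst (λ z → Walk R (z , 0) east) (sym x≡n) ε)
    ... | no  x≢n = ⊎-map (up ▸_) (up ▸_) (rowSide 0 (suc i) (s≤s 0<n') x≤n)
      where
        i<n' : i < n'
        i<n' = interior x≤n x≢n
        0<n' : 0 < n'
        0<n' = ≤-<-trans z≤n i<n'
        up : Step R (suc i , 0) (suc i , 1)
        up = verR i 0 i<n' 0<n' notKink

    -- R: at the kink, first step right along the row-0 R-edge.
    row0Side : ∀ x → x ≤ n → Walk R (x , 0) west ⊎ Walk R (x , 0) east
    row0Side x x≤n with (kink BoolP.≟ true) ×-dec (x ≟ t)
    ... | no  notKink = row0Side' x x≤n notKink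
    ... | yes (kinked , refl) =
      ⊎-map (right ▸_) (right ▸_) (row0Side' (suc x) (kink⇒t<n kinked) (λ { (_ , x+1≡x) → 1+n≢n x+1≡x }))
      where
        right : Step R (x , 0) (suc x , 0)
        right = horR x 0 (kink⇒t<n kinked) 0<n (kinked , refl)

    sideR : ∀ {w} → OnBoard w → Walk R w west ⊎ Walk R w east
    sideR {x , zero}  (x< , _)  = row0Side x (≤-pred x<)
    sideR {x , suc r} (x< , y<) = rowSide r x y< (≤-pred x<)

    upEast : ∀ k → suc k ≤ n → InRVer k 0 → cut 0 < suc k → Walk R (suc k , 0) east
    upEast k k+1≤n notKink cut<k+1 with suc k ≟ n
    ... | yes k+1≡n = subst (λ z → Walk R (z , 0) east) (sym k+1≡n) ε
    ... | no  k+1≢n = verR k 0 k<n' (≤-<-trans z≤n k<n') notKink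
                      ▸ rowEast 0 (suc k) (s≤s (≤-<-trans z≤n k<n')) k+1≤n cut<k+1
      where
        k<n' : k < n'
        k<n' = interior k+1≤n k+1≢n

    row0West : ∀ x → x ≤ n → (kink ≡ true → x ≤ t) → Walk P (x , 0) west
    row0West zero    _   _      = ε
    row0West (suc k) k<n before =
      stepSym (horP k 0 k<n 0<n (λ { (kinked , k≡t) → <⇒≢ (before kinked) k≡t }))
      ▸ row0West k (<⇒≤ k<n) (λ kinked → <⇒≤ (before kinked))

    row0East : ∀ x → x ≤ n → (kink ≡ true → t < x) → Walk P (x , 0) east
    row0East x x≤n = go (n ∸ x) x (m+[n∸m]≡n x≤n)
      where
        go : ∀ d x → x + d ≡ n → (kink ≡ true → t < x) → Walk P (x , 0) east
        go zero    x x+0≡n after = subst (λ z → Walk P (z , 0) east) (sym (trans (sym (+-identityʳ x)) x+0≡n)) ε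
        go (suc d) x x+d≡n after =
          horP x 0 (subst (x <_) x+d≡n (m<m+n x z<s)) 0<n (λ { (kinked , x≡t) → <⇒≢ (after kinked) (sym x≡t) })
          ▸ go d (suc x) (trans (sym (+-suc x d)) x+d≡n) (λ kinked → m<n⇒m<1+n (after kinked))

    row0SideP : ∀ x → x ≤ n → Walk P (x , 0) west ⊎ Walk P (x , 0) east
    row0SideP x x≤n with x ≤? t
    ... | yes x≤t = inj₁ (row0West x x≤n (λ _ → x≤t))
    ... | no  x≰t = beyond (kink BoolP.≟ true)
      where
        beyond : Dec (kink ≡ true) → Walk P (x , 0) west ⊎ Walk P (x , 0) east
        beyond (yes kinked) = inj₂ (row0East x x≤n (λ _ → ≰⇒> x≰t))
        beyond (no  flat)   = inj₁ (row0West x x≤n (λ kinked → ⊥-elim (flat kinked)))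

    columnDown : ∀ i j → i < n' → suc j < n → Walk P (suc i , suc j) (suc i , 1)
    columnDown i zero    _   _  = ε
    columnDown i (suc j) i<n' y< =
      stepSym (verP i (suc j) i<n' (≤-pred y<) λ ()) ▸ columnDown i j i<n' (<-trans (n<1+n (suc j)) y<)

    -- P: from row 1 of a column x ≥ t, climb to row x − t + 1, whose cut edge
    -- leads to column x + 1, descend there, and repeat until the right column
    -- (d + 1 columns away).
    stairsEast : ∀ d x → x + suc d ≡ n → t ≤ x → Walk P (x , 1) east
    stairsEast d zero    _     t≤0 = ⊥-elim (<⇒≱ 1≤t t≤0)
    stairsEast d (suc i) x+d≡n t≤x with m≤n⇒∃[o]m+o≡n t≤x
    ... | s , t+s≡x = reverse (columnDown i s (≤-pred x<n) s+1<n)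
                      ++w (horP (suc i) (suc s) x<n s+1<n (λ x≢cut → x≢cut (sym cut≡x)) ▸ onward d x+d≡n)
      where
        x<n : suc i < n
        x<n = subst (suc i <_) x+d≡n (m<m+n (suc i) z<s)
        s+1<n : suc s < n
        s+1<n = ≤-<-trans (subst (s <_) t+s≡x (m<n+m s 1≤t)) x<n
        cut≡x : cut s ≡ suc i
        cut≡x = cut-below s (suc i) (trans (+-comm s t) t+s≡x) x<n
        onward : ∀ d → suc i + suc d ≡ n → Walk P (suc (suc i) , suc s) east
        onward zero     x+1≡n = subst (λ z → Walk P (z , suc s) east) (sym (trans (+-comm 1 (suc i)) x+1≡n)) (toEast s+1<n)
        onward (suc d') x+d≡n' = columnDown (suc i) s (≤-pred x+1<n) s+1<n
                                 ++w stairsEast d' (suc (suc i)) x+1+d≡n (≤-trans t≤x (n≤1+n (suc i)))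
          where
            x+1+d≡n : suc (suc i) + suc d' ≡ n
            x+1+d≡n = trans (sym (+-suc (suc i) (suc d'))) x+d≡n'
            x+1<n : suc (suc i) < n
            x+1<n = subst (suc (suc i) <_) x+1+d≡n (m<m+n (suc (suc i)) z<s)

    -- P: from row 1 of a column i+1 < t, climb to the row whose cut edge leads
    -- back to column i, descend there (unless i = 0), and repeat until the left column.
    stairsWest : ∀ i → suc i < t → Walk P (suc i , 1) west
    stairsWest i i+1<t with m≤n⇒∃[o]m+o≡n t≤n
    ... | q , t+q≡n = reverse (columnDown i (i + q) (≤-pred x<n) row<n)
                      ++w (stepSym (horP i (suc (i + q)) (<-trans (n<1+n i) x<n) row<n (λ i≢cut → i≢cut (sym cut≡i)))
                           ▸ onward i refl)
      where
        x<n : suc i < n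
        x<n = <-≤-trans i+1<t t≤n
        row<n : suc (i + q) < n
        row<n = subst (suc (i + q) <_) t+q≡n (+-monoˡ-< q i+1<t)
        cut≡i : cut (i + q) ≡ i
        cut≡i = cut-wrap (i + q) i (trans (+-assoc i q t) (cong (i +_) (trans (+-comm q t) t+q≡n))) (<-trans (n<1+n i) x<n)
        onward : ∀ j → j ≡ i → Walk P (j , suc (i + q)) west
        onward zero    _    = toWest row<n
        onward (suc j) refl = columnDown j (i + q) (<-trans (n<1+n j) (≤-pred x<n)) row<n
                              ++w stairsWest j (<-trans (n<1+n (suc j)) i+1<t)

    upperSideP : ∀ i j → i < n' → suc j < n → Walk P (suc i , suc j) west ⊎ Walk P (suc i , suc j) east
    upperSideP i j i<n' y< with t ≤? suc i
    ... | yes t≤x = inj₂ (columnDown i j i<n' y< ++w stairsEast (n ∸ suc (suc i)) (suc i)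
                          (trans (+-suc (suc i) (n ∸ suc (suc i))) (m+[n∸m]≡n (s≤s i<n'))) t≤x)
    ... | no  t≰x = inj₁ (columnDown i j i<n' y< ++w stairsWest i (≰⇒> t≰x))

    sideP : ∀ {w} → OnBoard w → Walk P w west ⊎ Walk P w east
    sideP {x , zero}      (x< , _)  = row0SideP x (≤-pred x<)
    sideP {zero , suc j}  (_ , y<)  = inj₁ (toWest y<)
    sideP {suc i , suc j} (x< , y<) with suc i ≟ n
    ... | yes x≡n = inj₂ (subst (λ z → Walk P (z , suc j) east) (sym x≡n) (toEast y<))
    ... | no  x≢n = upperSideP i j (interior (≤-pred x<) x≢n) y<

    -- P joins west to east: along row 0, or, with a kink, along row 0 to
    -- column t, up its P-edge and along the stairs.
    westEastP : Walk P west east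
    westEastP = viaKink (kink BoolP.≟ true)
      where
        viaKink : Dec (kink ≡ true) → Walk P west east
        viaKink (no flat) = reverse (row0West n ≤-refl (λ kinked → ⊥-elim (flat kinked)))
        viaKink (yes kinked) = reverse (row0West t t≤n (λ _ → ≤-refl))
                               ++w (up ▸ stairsEast (n ∸ suc t) t (trans (+-suc t (n ∸ suc t)) (m+[n∸m]≡n t<n)) ≤-refl)
          where
            t<n : t < n
            t<n = kink⇒t<n kinked
            t-1+1≡t : suc (t ∸ 1) ≡ t
            t-1+1≡t = m+[n∸m]≡n 1≤t
            t-1<n' : t ∸ 1 < n'
            t-1<n' = ≤-pred (subst (_< n) (sym t-1+1≡t) t<n)
            up : Step P (t , 0) (t , 1)
            up = subst (λ z → Step P (z , 0) (z , 1)) t-1+1≡t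
                   (verP (t ∸ 1) 0 t-1<n' (≤-<-trans z≤n t-1<n') (λ notKink → notKink (kinked , t-1+1≡t)))

    spanP : Span P
    spanP = spanFrom west λ w∈ →
      [ (λ w→west → w→west) , (λ w→east → w→east ++w reverse westEastP) ]′ (sideP w∈)

    pairVia : ∀ e → ¬ InR e → ∀ {u v} → Walk R u west → Step (R ++ e ∷ []) u v → Walk R v east → SpanningPair e
    pairVia e e∉R u→west bridge v→east = record
      { P = P ; R = R ; e∈P = inP e e∉R ; separate = separate ; spanP = spanP
      ; spanR+e = spanFrom west λ w∈ →
          [ walkMono ∈-++⁺ˡ , (λ w→east → walkMono ∈-++⁺ˡ w→east ++w reverse westEast) ]′ (sideR w∈) }
      where
        westEast : Walk (R ++ e ∷ []) west east
        westEast = reverse (walkMono ∈-++⁺ˡ u→west) ++w (bridge ▸ walkMono ∈-++⁺ˡ v→east)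

  shiftFor : ∀ k r → k < n → suc r < n → Σ ℕ λ t → 1 ≤ t × t ≤ n × (r + t ≡ k ⊎ r + t ≡ k + n)
  shiftFor k r k<n r+1<n with r <? k
  ... | yes r<k with m≤n⇒∃[o]m+o≡n r<k
  ...   | s , r+1+s≡k = suc s , s≤s z≤n , ≤-trans (subst (suc s ≤_) r+1+s≡k (s≤s (m≤n+m s r))) (<⇒≤ k<n)
                      , inj₁ (trans (+-suc r s) r+1+s≡k)
  shiftFor k r k<n r+1<n | no r≮k with m≤n⇒∃[o]m+o≡n r+1<n
  ...   | q , r+2+q≡n = suc (suc k) + q , s≤s z≤n
                      , subst (suc (suc k) + q ≤_) r+2+q≡n (+-monoˡ-≤ q (s≤s (s≤s (≮⇒≥ r≮k))))
                      , inj₂ (trans (shuffle r k q) (cong (k +_) r+2+q≡n))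
    where
      shuffle : ∀ r k q → r + (suc (suc k) + q) ≡ k + (suc (suc r) + q)
      shuffle = solve-∀

  -- Every edge e admits a staircase pair: choose the shift (and kink) so that e
  -- is a P-edge bridging R's west part and R's east part.
  staircasePair : ∀ e → SpanningPair e
  -- Row 0, column 0: t = n puts row 1's cut at column 0, so (1 , 0) climbs east.
  staircasePair e@(hor F.zero F.zero) =
    pairVia e (λ { (() , _) }) {u = west} ε (edge (e , ∈-++⁺ʳ R (here refl) , inj₁ refl))
      (upEast 0 0<n (λ { (() , _) }) (subst (_< 1) (sym cut0≡0) z<s))
    where
      open Staircase n false (s≤s z≤n) ≤-refl (λ ())
      cut0≡0 : cut 0 ≡ 0
      cut0≡0 = cut-wrap 0 0 refl 0<n
  -- Row 0, column k+1: t = k+1 puts row 1's cut at column k+1; the ends of e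
  -- climb to row 1 just left of and just right of it.
  staircasePair e@(hor (F.suc i) F.zero) =
    pairVia e (λ { (() , _) }) u→west (edge (e , ∈-++⁺ʳ R (here refl) , inj₁ refl))
      (upEast (suc k) k+1<n (λ { (() , _) }) (subst (_< suc (suc k)) (sym cut0≡k+1) ≤-refl))
    where
      k : ℕ
      k = toℕ i
      k+1<n : suc k < n
      k+1<n = FP.toℕ<n (F.suc i)
      open Staircase (suc k) false (s≤s z≤n) (<⇒≤ k+1<n) (λ ())
      cut0≡k+1 : cut 0 ≡ suc k
      cut0≡k+1 = cut-below 0 (suc k) refl k+1<n
      0<n' : 0 < n'
      0<n' = ≤-<-trans z≤n (≤-pred k+1<n)
      u→west : Walk R (suc k , 0) west
      u→west = verR k 0 (≤-pred k+1<n) 0<n' (λ { (() , _) })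
               ▸ rowWest 0 (suc k) (s≤s 0<n') (≤-reflexive (sym cut0≡k+1))
  -- Row r+1, column k: choose t with cut r = k, making e the cut edge itself.
  staircasePair e@(hor i (F.suc j)) with shiftFor (toℕ i) (toℕ j) (FP.toℕ<n i) (FP.toℕ<n (F.suc j))
  ... | t , 1≤t , t≤n , shift =
    pairVia e (λ k≢cut → k≢cut (sym cut≡k)) (rowWest r k y< (≤-reflexive (sym cut≡k)))
      (edge (e , ∈-++⁺ʳ R (here refl) , inj₁ refl)) (rowEast r (suc k) y< k<n (subst (_< suc k) (sym cut≡k) ≤-refl))
    where
      k r : ℕ
      k = toℕ i
      r = toℕ j
      k<n : k < n
      k<n = FP.toℕ<n i
      y< : suc r < n
      y< = FP.toℕ<n (F.suc j)
      open Staircase t false 1≤t t≤n (λ ())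
      cut≡k : cut r ≡ k
      cut≡k = cut-shift r k shift k<n
  -- Vertical, column k+1, rows r+1 and r+2: choose t with cut r = k; then
  -- cut (r+1) = k+1, so the upper end leads west and the lower end east.
  staircasePair e@(ver i (F.suc j)) with shiftFor (toℕ i) (toℕ j) (<-trans (FP.toℕ<n i) (n<1+n n'))
                                                                 (<-trans (FP.toℕ<n (F.suc j)) (n<1+n n'))
  ... | t , 1≤t , t≤n , shift =
    pairVia e (λ ()) (rowWest (suc r) (suc k) y₂< (≤-reflexive (sym cut≡k+1)))
      (edge (e , ∈-++⁺ʳ R (here refl) , inj₂ refl))
      (rowEast r (suc k) y₁< (<⇒≤ k+1<n) (subst (_< suc k) (sym cut≡k) ≤-refl))
    where
      k r : ℕ
      k = toℕ i
      r = toℕ j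
      k+1<n : suc k < n
      k+1<n = s≤s (FP.toℕ<n i)
      y₁< : suc r < n
      y₁< = <-trans (FP.toℕ<n (F.suc j)) (n<1+n n')
      y₂< : suc (suc r) < n
      y₂< = s≤s (FP.toℕ<n (F.suc j))
      open Staircase t false 1≤t t≤n (λ ())
      cut≡k : cut r ≡ k
      cut≡k = cut-shift r k shift (<-trans (n<1+n k) k+1<n)
      cut≡k+1 : cut (suc r) ≡ suc k
      cut≡k+1 = cut-shift (suc r) (suc k) (⊎-map (cong suc) (cong suc) shift) k+1<n
  -- Vertical, column k+1, rows 0 and 1: a kink at t = k+1 makes e a P-edge; the
  -- upper end leads west, the lower end steps along the kink edge and climbs east.
  staircasePair e@(ver i F.zero) =
    pairVia e (λ notKink → notKink (refl , refl)) (rowWest 0 (suc k) (s≤s 0<n') (≤-reflexive (sym cut0≡k+1)))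
      (edge (e , ∈-++⁺ʳ R (here refl) , inj₂ refl))
      (horR (suc k) 0 k+1<n 0<n (refl , refl) ▸ upEast (suc k) k+1<n (λ { (_ , k+2≡k+1) → 1+n≢n k+2≡k+1 })
                                                      (subst (_< suc (suc k)) (sym cut0≡k+1) ≤-refl))
    where
      k : ℕ
      k = toℕ i
      k<n' : k < n'
      k<n' = FP.toℕ<n i
      k+1<n : suc k < n
      k+1<n = s≤s k<n'
      0<n' : 0 < n'
      0<n' = ≤-<-trans z≤n k<n'
      open Staircase (suc k) true (s≤s z≤n) (<⇒≤ k+1<n) (λ _ → k+1<n)
      cut0≡k+1 : cut 0 ≡ suc k
      cut0≡k+1 = cut-below 0 (suc k) refl k+1<n

theorem2p7 : (n : ℕ) (e : Edge (suc n) n) → MakerWinsAfter (suc n) n [] [] e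
theorem2p7 zero       (hor () _)
theorem2p7 zero       (ver () _)
theorem2p7 (suc n') e = Board.makerWinsFromPair (suc n') n' e (Square.staircasePair n' e)
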